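{- Let $w$ be a word and $v\in\mathrm{Prim}'(w)$ with $|v|=l$ and $\mathrm{Index}_w(v)\ge 2$. For every integer $t$ with $1\le t\le|\mathrm{Class}_w(v)|$, there exists a small circuit $C(v,t+l-1)$ in the Rauzy graph $\Gamma_{t+l-1}(w)$; i.e., every word $u^{(t+l)/l}$ with $u\in[v]$ is a factor of $w$. Hence there is a bijection $f_v$ from $\mathrm{Class}_w(v)$ to the set of small circuits $\{C(v,t+l-1)\mid 1\le t\le|\mathrm{Class}_w(v)|\}$.
   Context: A word is primitive if it is not of the form $z^m$ for a word $z$ and integer $m\ge2$; $\mathrm{Prim}(w)$ is the set of primitive factors of $w$; $\mathrm{Fac}(w)$ is the set of factors (contiguous subwords) of $w$. $[v]$ is the set of words conjugate to $v$ (words $ba$ where $v=ab$). For a nonempty word $p$ and rational $x>0$ with $x|p|$ an integer, $p^x$ denotes the prefix of length $x|p|$ of $ppp\cdots$. $\mathrm{Class}_w(v)$ is the set of factors of $w$ of the form $y^p$, $y\in[v]$, integer $p\ge2$. $m_w(u)=\max\{n\ge1\mid u^n\in\mathrm{Fac}(w)\}$, $\mathrm{Index}_w(v)=\max\{m_w(u)\mid u\in[v]\}$, and $\mathrm{Prim}'(w)=\{v\in\mathrm{Prim}(w)\mid v^{\mathrm{Index}_w(v)}\in\mathrm{Class}_w(v)\}$. For $1\le r\le|w|$, the Rauzy graph $\Gamma_r(w)$ is the directed graph whose vertices are the length-$r$ factors of $w$ and whose edges are the length-$(r+1)$ factors of $w$, an edge $e$ going from its length-$r$ prefix to its length-$r$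 suffix. An elementary circuit of size $j$ consists of $j$ distinct vertices $v_1,\dots,v_j$ and $j$ distinct edges $e_1,\dots,e_j$ with $e_i$ from $v_i$ to $v_{i+1}$ ($i<j$) and $e_j$ from $v_j$ to $v_1$; a small circuit in $\Gamma_r(w)$ is an elementary circuit of size at most $r$. For a primitive word $q$ with $|q|\le r$, $C(q,r)$ denotes the small circuit in $\Gamma_r(w)$ (if it exists) whose vertex set is $\{p^{r/|p|}\mid p\in[q]\}$ and edge set is $\{p^{(r+1)/|p|}\mid p\in[q]\}$. -}

module Defs where

open import Data.Nat using (ℕ; zero; suc; _+_; _≤_)
open import Data.List using (List; []; _∷_; _++_; take; concat; replicate; length)
open import Data.List.Membership.Propositional using (_∈_)
open import Data.List.Relation.Unary.Unique.Propositional using (Unique)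
open import Data.Product using (Σ; ∃; ∃-syntax; _×_)
open import Relation.Binary.PropositionalEquality using (_≡_)
open import Relation.Nullary using (¬_)
open import Function.Bundles using (_⇔_)

module _ {A : Set} where

  Word : Set
  Word = List A

  _^_ : Word → ℕ → Word
  u ^ n = concat (replicate n u)

  Factor : Word → Word → Set
  Factor u w = ∃[ x ] ∃[ y ] (w ≡ x ++ u ++ y)

  -- primitive: not of the form z^m with m ≥ 2 (the empty word is not primitive)
  Primitive : Word → Set
  Primitive v = ¬ (∃[ z ] ∃[ m ] (2 ≤ m × v ≡ z ^ m))

  Conj : Word → Word → Set
  Conj v y = ∃[ a ] ∃[ b ] (v ≡ a ++ b × y ≡ b ++ a)

  -- fractional power: prefix of length n of ppp⋯ (p nonempty);
  -- p^(n/|p|) in the paper's notation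
  fracPow : Word → ℕ → Word
  fracPow p n = take n (p ^ n)

  InClass : Word → Word → Word → Set
  InClass w v x = Factor x w × ∃[ y ] ∃[ p ] (Conj v y × 2 ≤ p × x ≡ y ^ p)

  ClassCard : Word → Word → ℕ → Set
  ClassCard w v n = ∃[ L ] (Unique L × length L ≡ n × (∀ x → (x ∈ L) ⇔ InClass w v x))

  IsIndex : Word → Word → ℕ → Set
  IsIndex w v k =
    (1 ≤ k × ∃[ u ] (Conj v u × Factor (u ^ k) w))
    × (∀ u n → Conj v u → 1 ≤ n → Factor (u ^ n) w → n ≤ k)

  InPrim' : Word → Word → Set
  InPrim' w v = Primitive v × Factor v w ×
                (∀ k → IsIndex w v k → InClass w v (v ^ k))

{-# OPTIONS --safe #-}
module Submission where

-- Write u = b a with v = a b, so that fracPow u m is the factor of length m of the periodic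
-- word v v v ⋯ starting at position J = |a|. An element x = y^p of Class_w(v) is the factor of
-- length p·l starting at some position, which a shift by a multiple of l moves into (J, J + l].
-- The suffix of x from position J + l on is then fracPow u r(x), where r(x) > l because p ≥ 2,
-- and x is recovered from r(x) by division with remainder by l. So the n elements of
-- Class_w(v) have n distinct run lengths r(x) > l; the largest is ≥ n + l, and
-- fracPow u (n + l) is a factor of that x, hence of w.

open import Defs
open import Data.Nat using (ℕ; zero; suc; _+_; _*_; _⊓_; _≤_; _<_; _∸_; _≤?_; z≤n; s≤s; NonZero)
open import Data.Nat.Properties
open import Data.Nat.DivMod using (_%_; _/_; [m+kn]%n≡m%n; [m+n]%n≡m%n; m%n<n; m<n⇒m%n≡m; m≡m%n+[m/n]*n; %-distribˡ-+; m%n%n≡m%n)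
open import Data.Fin using (Fin; fromℕ<)
open import Data.Fin.Properties using (any?; injective⇒≤; fromℕ<-injective)
open import Data.List using (List; []; _∷_; _++_; take; drop; length; lookup)
open import Data.List.Properties using (++-identityʳ; take++drop≡id; ++-assoc; length-++; length-++-comm; length-++-≤ˡ; take-drop; take-take; drop-drop; take-all)
open import Data.List.Membership.Propositional.Properties using (∈-lookup)
open import Data.List.Relation.Unary.All as All using ()
open import Data.List.Relation.Unary.AllPairs using (_∷_)
open import Data.List.Relation.Unary.Unique.Propositional using (Unique)
open import Data.Product using (∃-syntax; _×_; _,_; proj₁)
open import Data.Sum using (inj₁; inj₂)
open import Function using (_∘_)
open import Function.Bundles using (Equivalence)
open import Function.Definitions using (Injective)
open import Relation.Binary.PropositionalEquality
open import Relation.Nullary using (yes; no; contradiction)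

injective⇒∃[lo+n≤f] : ∀ {n lo} (f : Fin (suc n) → ℕ) → Injective _≡_ _≡_ f →
                      (∀ i → lo ≤ f i) → ∃[ i ] lo + n ≤ f i
injective⇒∃[lo+n≤f] {n} {lo} f f-inj lo≤f with any? (λ i → lo + n ≤? f i)
... | yes large = large
... | no ¬large = contradiction (injective⇒≤ g-inj) 1+n≰n
  where
    f∸lo<n : ∀ i → f i ∸ lo < n
    f∸lo<n i = subst (f i ∸ lo <_) (m+n∸m≡n lo n)
                 (∸-monoˡ-< (≰⇒> (¬large ∘ (i ,_))) (lo≤f i))
    g : Fin (suc n) → Fin n
    g i = fromℕ< (f∸lo<n i)
    g-inj : Injective _≡_ _≡_ g
    g-inj {i} {j} gi≡gj = f-inj (∸-cancelʳ-≡ (lo≤f i) (lo≤f j)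
                            (fromℕ<-injective _ _ (f∸lo<n i) (f∸lo<n j) gi≡gj))

divMod-injective : ∀ {r r′ q q′ n} .{{_ : NonZero n}} → r < n → r′ < n →
                   r + q * n ≡ r′ + q′ * n → r ≡ r′ × q ≡ q′
divMod-injective {r} {r′} {q} {q′} {n} r<n r′<n eq = r≡r′ , q≡q′
  where
    r≡r′ : r ≡ r′
    r≡r′ = begin
      r                 ≡⟨ m<n⇒m%n≡m r<n ⟨
      r % n             ≡⟨ [m+kn]%n≡m%n r q n ⟨
      (r + q * n) % n   ≡⟨ cong (_% n) eq ⟩
      (r′ + q′ * n) % n ≡⟨ [m+kn]%n≡m%n r′ q′ n ⟩
      r′ % n            ≡⟨ m<n⇒m%n≡m r′<n ⟩
      r′                ∎
      where open ≡-Reasoning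
    q≡q′ : q ≡ q′
    q≡q′ = *-cancelʳ-≡ q q′ n (+-cancelˡ-≡ r _ _ (trans eq (cong (_+ q′ * n) (sym r≡r′))))

∃-shift-to-residue : ∀ i j n .{{_ : NonZero n}} → ∃[ r ] r < n × (j + r) % n ≡ i % n
∃-shift-to-residue i j n = N % n , m%n<n N n , (begin
  (j + N % n) % n          ≡⟨ %-distribˡ-+ j (N % n) n ⟩
  (j % n + N % n % n) % n  ≡⟨ cong (λ z → (j % n + z) % n) (m%n%n≡m%n N n) ⟩
  (j % n + N % n) % n      ≡⟨ %-distribˡ-+ j N n ⟨
  (j + N) % n              ≡⟨ cong (_% n) (m+[n∸m]≡n j≤i+j*n) ⟩
  (i + j * n) % n          ≡⟨ [m+kn]%n≡m%n i j n ⟩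
  i % n                    ∎)
  where
    open ≡-Reasoning
    N : ℕ
    N = i + j * n ∸ j
    j≤i+j*n : j ≤ i + j * n
    j≤i+j*n = ≤-trans (m≤m*n j n) (m≤n+m (j * n) i)

lookup-injective : ∀ {B : Set} {xs : List B} → Unique xs → ∀ i j → lookup xs i ≡ lookup xs j → i ≡ j
lookup-injective (_    ∷ _)    Fin.zero    Fin.zero    _  = refl
lookup-injective (x∉xs ∷ _)    Fin.zero    (Fin.suc j) eq = contradiction eq (All.lookup x∉xs (∈-lookup j))
lookup-injective (x∉xs ∷ _)    (Fin.suc i) Fin.zero    eq = contradiction (sym eq) (All.lookup x∉xs (∈-lookup i))
lookup-injective (_    ∷ uniq) (Fin.suc i) (Fin.suc j) eq = cong Fin.suc (lookup-injective uniq i j eq)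

module _ {A : Set} where

  take-++ˡ : ∀ {m} (xs ys : List A) → m ≤ length xs → take m (xs ++ ys) ≡ take m xs
  take-++ˡ {zero}  _        _  _         = refl
  take-++ˡ {suc m} (x ∷ xs) ys (s≤s m≤) = cong (x ∷_) (take-++ˡ xs ys m≤)

  drop-length-++ : (xs ys : List A) → drop (length xs) (xs ++ ys) ≡ ys
  drop-length-++ []       ys = refl
  drop-length-++ (x ∷ xs) ys = drop-length-++ xs ys

  take-drop-++ˡ : ∀ {i m} (xs ys : List A) → i + m ≤ length xs →
                  take m (drop i (xs ++ ys)) ≡ take m (drop i xs)
  take-drop-++ˡ {i} {m} xs ys bound = begin
    take m (drop i (xs ++ ys))       ≡⟨ take-drop m i (xs ++ ys) ⟩
    drop i (take (i + m) (xs ++ ys)) ≡⟨ cong (drop i) (take-++ˡ xs ys bound) ⟩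
    drop i (take (i + m) xs)         ≡⟨ take-drop m i xs ⟨
    take m (drop i xs)               ∎
    where open ≡-Reasoning

  take-drop-take : ∀ {s m n} (xs : List A) → s + m ≤ n →
                   take m (drop s (take n xs)) ≡ take m (drop s xs)
  take-drop-take {s} {m} {n} xs bound = begin
    take m (drop s (take n xs))       ≡⟨ take-drop m s (take n xs) ⟩
    drop s (take (s + m) (take n xs)) ≡⟨ cong (drop s) (take-take (s + m) n xs) ⟩
    drop s (take ((s + m) ⊓ n) xs)    ≡⟨ cong (λ k → drop s (take k xs)) (m≤n⇒m⊓n≡m bound) ⟩
    drop s (take (s + m) xs)          ≡⟨ take-drop m s xs ⟨
    take m (drop s xs)                ∎
    where open ≡-Reasoning

  Factor-trans : {x y z : List A} → Factor x y → Factor y z → Factor x z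
  Factor-trans {x} (p , s , refl) (p′ , s′ , refl) =
    p′ ++ p , s ++ s′ , (begin
      p′ ++ (p ++ x ++ s) ++ s′   ≡⟨ cong (p′ ++_) (++-assoc p (x ++ s) s′) ⟩
      p′ ++ p ++ (x ++ s) ++ s′   ≡⟨ cong (λ z → p′ ++ p ++ z) (++-assoc x s s′) ⟩
      p′ ++ p ++ x ++ s ++ s′     ≡⟨ ++-assoc p′ p _ ⟨
      (p′ ++ p) ++ x ++ s ++ s′   ∎)
    where open ≡-Reasoning

  take-drop-Factor : ∀ s m (xs : List A) → Factor (take m (drop s xs)) xs
  take-drop-Factor s m xs = take s xs , drop m (drop s xs) ,
    sym (trans (cong (take s xs ++_) (take++drop≡id m (drop s xs))) (take++drop≡id s xs))

  ^-+ : ∀ (u : List A) m n → u ^ (m + n) ≡ u ^ m ++ u ^ n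
  ^-+ u zero    n = refl
  ^-+ u (suc m) n = trans (cong (u ++_) (^-+ u m n)) (sym (++-assoc u (u ^ m) (u ^ n)))

  length-^ : ∀ (u : List A) n → length (u ^ n) ≡ n * length u
  length-^ u zero    = refl
  length-^ u (suc n) = trans (length-++ u) (cong (length u +_) (length-^ u n))

  drop-^ : ∀ (v : List A) k n → drop (k * length v) (v ^ (k + n)) ≡ v ^ n
  drop-^ v k n = begin
    drop (k * length v) (v ^ (k + n))           ≡⟨ cong (drop (k * length v)) (^-+ v k n) ⟩
    drop (k * length v) (v ^ k ++ v ^ n)        ≡⟨ cong (λ j → drop j (v ^ k ++ v ^ n)) (length-^ v k) ⟨
    drop (length (v ^ k)) (v ^ k ++ v ^ n)      ≡⟨ drop-length-++ (v ^ k) (v ^ n) ⟩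
    v ^ n                                       ∎
    where open ≡-Reasoning

  ^-suc-conj : ∀ (a b : List A) n → (a ++ b) ^ suc n ≡ a ++ (b ++ a) ^ n ++ b
  ^-suc-conj a b zero    = ++-identityʳ (a ++ b)
  ^-suc-conj a b (suc n) = begin
    (a ++ b) ++ (a ++ b) ^ suc n       ≡⟨ cong ((a ++ b) ++_) (^-suc-conj a b n) ⟩
    (a ++ b) ++ a ++ (b ++ a) ^ n ++ b ≡⟨ ++-assoc a b _ ⟩
    a ++ b ++ a ++ (b ++ a) ^ n ++ b   ≡⟨ cong (a ++_) (++-assoc b a _) ⟨
    a ++ (b ++ a) ++ (b ++ a) ^ n ++ b ≡⟨ cong (a ++_) (++-assoc (b ++ a) _ b) ⟨
    a ++ ((b ++ a) ++ (b ++ a) ^ n) ++ b ∎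
    where open ≡-Reasoning

  -- The factor of v v v ⋯ of length m at position i; v ^ (i + m) is long enough when v ≠ [].
  window : List A → ℕ → ℕ → List A
  window v i m = take m (drop i (v ^ (i + m)))

  module Periodic (v : List A) .{{_ : NonZero (length v)}} where

    ℓ : ℕ
    ℓ = length v

    take-drop-^-stable : ∀ {i m P Q} → P ≤ Q → i + m ≤ P * ℓ →
                         take m (drop i (v ^ Q)) ≡ take m (drop i (v ^ P))
    take-drop-^-stable {i} {m} {P} {Q} P≤Q bound = begin
      take m (drop i (v ^ Q))                  ≡⟨ cong (λ k → take m (drop i (v ^ k))) (m+[n∸m]≡n P≤Q) ⟨
      take m (drop i (v ^ (P + (Q ∸ P))))      ≡⟨ cong (take m ∘ drop i) (^-+ v P (Q ∸ P)) ⟩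
      take m (drop i (v ^ P ++ v ^ (Q ∸ P)))   ≡⟨ take-drop-++ˡ (v ^ P) _ (subst (i + m ≤_) (sym (length-^ v P)) bound) ⟩
      take m (drop i (v ^ P))                  ∎
      where open ≡-Reasoning

    window-^ : ∀ {i m} P → i + m ≤ P * ℓ → window v i m ≡ take m (drop i (v ^ P))
    window-^ {i} {m} P bound with ≤-total P (i + m)
    ... | inj₁ P≤i+m = take-drop-^-stable P≤i+m bound
    ... | inj₂ i+m≤P = sym (take-drop-^-stable i+m≤P (m≤m*n (i + m) ℓ))

    window-periodic : ∀ i k m → window v (i + k * ℓ) m ≡ window v i m
    window-periodic i k m = begin
      window v (i + k * ℓ) m                             ≡⟨ window-^ (k + (i + m)) bound ⟩
      take m (drop (i + k * ℓ) (v ^ (k + (i + m))))      ≡⟨ cong (λ j → take m (drop j (v ^ (k + (i + m))))) (+-comm i (k * ℓ)) ⟩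
      take m (drop (k * ℓ + i) (v ^ (k + (i + m))))      ≡⟨ cong (take m) (drop-drop (k * ℓ) i _) ⟨
      take m (drop i (drop (k * ℓ) (v ^ (k + (i + m))))) ≡⟨ cong (take m ∘ drop i) (drop-^ v k (i + m)) ⟩
      window v i m                                       ∎
      where
        open ≡-Reasoning
        bound : i + k * ℓ + m ≤ (k + (i + m)) * ℓ
        bound = subst (i + k * ℓ + m ≤_) (sym (*-distribʳ-+ ℓ k (i + m)))
                  (≤-trans (≤-reflexive (trans (cong (_+ m) (+-comm i (k * ℓ))) (+-assoc (k * ℓ) i m)))
                     (+-monoʳ-≤ (k * ℓ) (m≤m*n (i + m) ℓ)))

    window-cong-% : ∀ {i j} m → i % ℓ ≡ j % ℓ → window v i m ≡ window v j m
    window-cong-% {i} {j} m i≡j = begin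
      window v i m                                ≡⟨ cong (λ k → window v k m) (m≡m%n+[m/n]*n i ℓ) ⟩
      window v (i % ℓ + (i / ℓ) * ℓ) m            ≡⟨ window-periodic (i % ℓ) (i / ℓ) m ⟩
      window v (i % ℓ) m                          ≡⟨ cong (λ k → window v k m) i≡j ⟩
      window v (j % ℓ) m                          ≡⟨ window-periodic (j % ℓ) (j / ℓ) m ⟨
      window v (j % ℓ + (j / ℓ) * ℓ) m            ≡⟨ cong (λ k → window v k m) (m≡m%n+[m/n]*n j ℓ) ⟨
      window v j m                                ∎
      where open ≡-Reasoning

    window-Factor : ∀ {i s m n} → s + m ≤ n → Factor (window v (i + s) m) (window v i n)
    window-Factor {i} {s} {m} {n} s+m≤n =
      subst (λ x → Factor x (window v i n)) eq (take-drop-Factor s m (window v i n))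
      where
        open ≡-Reasoning
        V : List A
        V = v ^ (i + n)
        bound : i + s + m ≤ (i + n) * ℓ
        bound = ≤-trans (≤-reflexive (+-assoc i s m))
                  (≤-trans (+-monoʳ-≤ i s+m≤n) (m≤m*n (i + n) ℓ))
        eq : take m (drop s (window v i n)) ≡ window v (i + s) m
        eq = begin
          take m (drop s (take n (drop i V))) ≡⟨ take-drop-take (drop i V) s+m≤n ⟩
          take m (drop s (drop i V))          ≡⟨ cong (take m) (drop-drop i s V) ⟩
          take m (drop (i + s) V)             ≡⟨ window-^ (i + n) bound ⟨
          window v (i + s) m                  ∎

    take-conj-^ : ∀ a b {m} N → v ≡ a ++ b → m ≤ N * ℓ → take m ((b ++ a) ^ N) ≡ window v (length a) m
    take-conj-^ a b {m} N v≡ab m≤N*ℓ = begin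
      take m ((b ++ a) ^ N)                            ≡⟨ take-++ˡ _ b m≤length ⟨
      take m ((b ++ a) ^ N ++ b)                       ≡⟨ cong (take m) (drop-length-++ a _) ⟨
      take m (drop (length a) (a ++ (b ++ a) ^ N ++ b)) ≡⟨ cong (take m ∘ drop (length a)) (^-suc-conj a b N) ⟨
      take m (drop (length a) ((a ++ b) ^ suc N))      ≡⟨ cong (λ z → take m (drop (length a) (z ^ suc N))) v≡ab ⟨
      take m (drop (length a) (v ^ suc N))             ≡⟨ window-^ (suc N) bound ⟨
      window v (length a) m                            ∎
      where
        open ≡-Reasoning
        m≤length : m ≤ length ((b ++ a) ^ N)
        m≤length = subst (m ≤_) (trans (cong (λ k → N * length k) v≡ab)
                                   (trans (cong (N *_) (length-++-comm a b)) (sym (length-^ (b ++ a) N))))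
                     m≤N*ℓ
        bound : length a + m ≤ suc N * ℓ
        bound = +-mono-≤ (subst (length a ≤_) (sym (cong length v≡ab)) (length-++-≤ˡ a)) m≤N*ℓ

    fracPow-conj : ∀ a b {m} → v ≡ a ++ b → fracPow (b ++ a) m ≡ window v (length a) m
    fracPow-conj a b {m} v≡ab = take-conj-^ a b m v≡ab (m≤m*n m ℓ)

    ^-conj : ∀ a b p → v ≡ a ++ b → (b ++ a) ^ p ≡ window v (length a) (p * ℓ)
    ^-conj a b p v≡ab = trans (sym (take-all (p * ℓ) ((b ++ a) ^ p) length≤)) (take-conj-^ a b p v≡ab ≤-refl)
      where
        length≤ : length ((b ++ a) ^ p) ≤ p * ℓ
        length≤ = ≤-reflexive (trans (length-^ (b ++ a) p)
                    (cong (p *_) (trans (length-++-comm b a) (sym (cong length v≡ab)))))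

    -- x is the window of length (q + 1)ℓ starting at a position in (J, J + ℓ]; its suffix from
    -- position J + ℓ on is the window at J (up to a period) of length runLength.
    record Normalised (J : ℕ) (x : List A) : Set where
      field
        ρ q : ℕ
        ρ<ℓ : ρ < ℓ
        1≤q : 1 ≤ q
        x≡window : x ≡ window v (suc J + ρ) (suc q * ℓ)

      runLength : ℕ
      runLength = suc (ρ + q * ℓ)

    open Normalised

    normalise : ∀ J {y p} → Conj v y → 2 ≤ p → Normalised J (y ^ p)
    normalise J {p = suc zero}    _                      (s≤s ())
    normalise J {p = suc (suc q)} (a , b , v≡ab , refl) _ with ∃-shift-to-residue (length a) (suc J) ℓ
    ... | r , r<ℓ , start≡a = record
      { ρ = r ; q = suc q ; ρ<ℓ = r<ℓ ; 1≤q = s≤s z≤n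
      ; x≡window = trans (^-conj a b (suc (suc q)) v≡ab) (window-cong-% _ (sym start≡a)) }

    ℓ<runLength : ∀ {J x} (nf : Normalised J x) → ℓ < runLength nf
    ℓ<runLength nf = s≤s (≤-trans (≤-trans (≤-reflexive (sym (*-identityˡ ℓ))) (*-monoˡ-≤ ℓ (1≤q nf)))
                                   (m≤n+m (q nf * ℓ) (ρ nf)))

    Normalised-injective : ∀ {J x x′} (nf : Normalised J x) (nf′ : Normalised J x′) →
                           runLength nf ≡ runLength nf′ → x ≡ x′
    Normalised-injective {J} nf nf′ eq
      with ρ≡ρ′ , q≡q′ ← divMod-injective {q = q nf} {q′ = q nf′} (ρ<ℓ nf) (ρ<ℓ nf′) (suc-injective eq) =
      trans (x≡window nf)
        (trans (cong₂ (λ r k → window v (suc J + r) (suc k * ℓ)) ρ≡ρ′ q≡q′) (sym (x≡window nf′)))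

    Normalised-Factor : ∀ {J x m} (nf : Normalised J x) → m ≤ runLength nf → Factor (window v J m) x
    Normalised-Factor {J} {x} {m} nf m≤run =
      subst₂ Factor (window-cong-% m start+s≡J) (sym (x≡window nf)) (window-Factor {i = suc J + ρ nf} s+m≤)
      where
        open ≤-Reasoning
        s : ℕ
        s = ℓ ∸ suc (ρ nf)
        start+s≡J : (suc J + ρ nf + s) % ℓ ≡ J % ℓ
        start+s≡J = trans (cong (_% ℓ) (begin-equality
          suc J + ρ nf + s            ≡⟨ cong (_+ s) (+-suc J (ρ nf)) ⟨
          J + suc (ρ nf) + s          ≡⟨ +-assoc J (suc (ρ nf)) s ⟩
          J + (suc (ρ nf) + s)        ≡⟨ cong (J +_) (m+[n∸m]≡n (ρ<ℓ nf)) ⟩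
          J + ℓ                       ∎)) ([m+n]%n≡m%n J ℓ)
        s+m≤ : s + m ≤ suc (q nf) * ℓ
        s+m≤ = begin
          s + m                       ≤⟨ +-monoʳ-≤ s m≤run ⟩
          s + (suc (ρ nf) + q nf * ℓ) ≡⟨ +-assoc s (suc (ρ nf)) (q nf * ℓ) ⟨
          s + suc (ρ nf) + q nf * ℓ   ≡⟨ cong (_+ q nf * ℓ) (m∸n+n≡m (ρ<ℓ nf)) ⟩
          ℓ + q nf * ℓ                ∎

    InClass⇒Normalised : ∀ {w x} J → InClass w v x → Normalised J x
    InClass⇒Normalised J (_ , _ , _ , v~y , 2≤p , refl) = normalise J v~y 2≤p

    ClassCard⇒window-Factor : ∀ {w n m} J → ClassCard w v n → 1 ≤ n → m ≤ n + ℓ → Factor (window v J m) w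
    ClassCard⇒window-Factor {w} {m = m} J (L@(_ ∷ xs) , uniq , refl , ∈L⇔class) _ m≤n+ℓ =
      let i , long = injective⇒∃[lo+n≤f] run run-inj (λ i → ℓ<runLength (nf i))
      in Factor-trans (Normalised-Factor (nf i) (≤-trans m≤n+ℓ (subst (_≤ run i) (sym n+ℓ≡1+ℓ+n′) long))) (proj₁ (class i))
      where
        class : ∀ i → InClass w v (lookup L i)
        class i = Equivalence.to (∈L⇔class _) (∈-lookup i)
        nf : ∀ i → Normalised J (lookup L i)
        nf i = InClass⇒Normalised J (class i)
        run : Fin (length L) → ℕ
        run i = runLength (nf i)
        run-inj : Injective _≡_ _≡_ run
        run-inj {i} {j} eq = lookup-injective uniq i j (Normalised-injective (nf i) (nf j) eq)
        n+ℓ≡1+ℓ+n′ : length L + ℓ ≡ suc ℓ + length xs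
        n+ℓ≡1+ℓ+n′ = trans (+-comm (length L) ℓ) (+-suc ℓ (length xs))

  primitive⇒NonZero : ∀ {v : List A} → Primitive v → NonZero (length v)
  primitive⇒NonZero {[]}    prim = contradiction ([] , 2 , s≤s (s≤s z≤n) , refl) prim
  primitive⇒NonZero {_ ∷ _} _    = _

mainTheorem5 : {A : Set} (w v : List A) (k n : ℕ) →
    InPrim' w v → IsIndex w v k → 2 ≤ k → ClassCard w v n →
    (t : ℕ) → 1 ≤ t → t ≤ n →
    (u : List A) → Conj v u →
      Factor (fracPow u (t + length v ∸ 1)) w × Factor (fracPow u (t + length v)) w
mainTheorem5 w v k n (prim , _ , _) _ _ card t 1≤t t≤n _ (a , b , v≡ab , refl) =
  factor (≤-trans (m∸n≤m (t + length v) 1) t+ℓ≤n+ℓ) , factor t+ℓ≤n+ℓ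
  where
    open Periodic v {{primitive⇒NonZero prim}}
    t+ℓ≤n+ℓ : t + ℓ ≤ n + ℓ
    t+ℓ≤n+ℓ = +-monoˡ-≤ ℓ t≤n
    factor : ∀ {m} → m ≤ n + ℓ → Factor (fracPow (b ++ a) m) w
    factor m≤n+ℓ = subst (λ x → Factor x w) (sym (fracPow-conj a b v≡ab))
                     (ClassCard⇒window-Factor (length a) card (≤-trans 1≤t t≤n) m≤n+ℓ)
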